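{- There exists a super-simple $(5,2)$-DGDD of type $5^5$ with $d\geq \frac12$.
   Context: A $(5,2)$-DGDD of type $g_1^{u_1}\cdots g_n^{u_n}$ is a triple $(X,\mathcal G,\mathcal B)$ where $\mathcal G$ is a partition of the set $X$ into groups, consisting of $u_i$ groups of size $g_i$ for each $i$; $\mathcal B$ is a collection of blocks, each an ordered $5$-tuple of distinct points of $X$ meeting every group in at most one point; and every ordered pair $(x,y)$ of points lying in distinct groups is contained in exactly $2$ blocks (a block $(b_1,\dots,b_5)$ contains $(b_i,b_j)$ for $i<j$). It is super-simple if any two blocks, regarded as unordered sets, intersect in at most two points. A defining set is a subset $S\subseteq\mathcal B$ such that $(X,\mathcal G,\mathcal B)$ is the unique $(5,2)$-DGDD with point set $X$ and group set $\mathcal G$ whose blocks contain $S$; $d$ is the size of a smallest defining set divided by $|\mathcal B|$. -}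

module Defs where

open import Data.Nat using (ℕ)
open import Data.Empty using (⊥)
open import Data.Fin using (Fin; quotient; _<_)
open import Data.Fin.Subset using (Subset; _∈_)
open import Data.Vec using (Vec; lookup)
open import Data.Product using (Σ; ∃; ∃-syntax; _×_)
open import Data.Sum using (_⊎_)
open import Relation.Binary.PropositionalEquality using (_≡_; _≢_)
open import Function.Bundles using (_↔_; Inverse)

-- Point set X = Fin 25, partitioned into 5 groups of size 5 (type 5^5):
-- point x lies in group ⌊x/5⌋.
Point : Set
Point = Fin 25

group : Point → Fin 5
group = quotient {5} 5

Block : Set
Block = Vec Point 5

Transversal : Block → Set
Transversal b = ∀ (i j : Fin 5) → i ≢ j → group (lookup b i) ≢ group (lookup b j)

ContainsPair : Block → Point → Point → Set
ContainsPair b x y = ∃[ i ] ∃[ j ] (i < j × lookup b i ≡ x × lookup b j ≡ y)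

-- A collection (multiset) of blocks, indexed by Fin n.
-- (5,2)-DGDD of type 5^5 on (Point, group):
IsDGDD : ∀ {n} → (Fin n → Block) → Set
IsDGDD {n} B =
  (∀ k → Transversal (B k)) ×
  (∀ (x y : Point) → group x ≢ group y →
     ∃[ k₁ ] ∃[ k₂ ] (k₁ ≢ k₂ × ContainsPair (B k₁) x y × ContainsPair (B k₂) x y ×
        (∀ k → ContainsPair (B k) x y → k ≡ k₁ ⊎ k ≡ k₂)))

_∈B_ : Point → Block → Set
x ∈B b = ∃[ i ] lookup b i ≡ x

SuperSimple : ∀ {n} → (Fin n → Block) → Set
SuperSimple {n} B = ∀ (k l : Fin n) → k ≢ l → ∀ (x y z : Point) →
  x ≢ y → x ≢ z → y ≢ z →
  x ∈B B k → y ∈B B k → z ∈B B k → x ∈B B l → y ∈B B l → z ∈B B l →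
  ⊥

SubContained : ∀ {n m} → (Fin n → Block) → Subset n → (Fin m → Block) → Set
SubContained {n} {m} B S B' = Σ (Fin n → Fin m) λ f →
  (∀ i j → i ∈ S → j ∈ S → f i ≡ f j → i ≡ j) ×
  (∀ i → i ∈ S → B' (f i) ≡ B i)

SameBlocks : ∀ {n m} → (Fin n → Block) → (Fin m → Block) → Set
SameBlocks {n} {m} B B' = Σ (Fin n ↔ Fin m) λ e → ∀ i → B' (Inverse.to e i) ≡ B i

IsDefiningSet : ∀ {n} → (Fin n → Block) → Subset n → Set
IsDefiningSet {n} B S = ∀ (m : ℕ) (B' : Fin m → Block) →
  IsDGDD B' → SubContained B S B' → SameBlocks B B'

-- The design has 100 blocks, and for each t < 50 there are points x, y standing adjacent as
-- (x, y) in block t and adjacent as (y, x) in block 50 + t. Swapping both adjacent pairs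
-- exchanges the ordered pairs (x, y) and (y, x) between the two blocks and changes no other
-- pair count, so it yields another DGDD B′ on the same groups, and its new block t is not a
-- block of the design. A defining set containing neither block t nor block 50 + t is
-- contained in B′ as well, which would force B′ to have the same blocks as the design. Hence
-- every defining set meets each of the 50 disjoint index pairs {t, 50 + t}, so it has at least
-- 50 = 100 / 2 blocks.

module Submission where

open import Defs
open import Data.Nat using (_≤_; _*_)
open import Data.Fin using (Fin)
open import Data.Fin.Subset using (Subset; ∣_∣)
open import Data.Product using (∃; ∃-syntax; _×_)

open import Data.Fin using (zero; suc; #_; inject₁; opposite; _↑ˡ_; _↑ʳ_; _<_)
open import Data.Fin.Permutation using (Permutation′; _⟨$⟩ʳ_; _⟨$⟩ˡ_; inverseˡ; inverseʳ; transpose)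
import Data.Fin.Permutation as Permutation
open import Data.Fin.Properties using (_≟_; _<?_; any?; all?; ≤̄⇒inject₁<; ≤-refl; <-asym)
open import Data.Fin.Subset using (_∈_; _-_; inside; outside)
open import Data.Fin.Subset.Properties
  using (_∈?_; x∈p⇒∣p-x∣<∣p∣; x∈p∧x≢y⇒x∈p-y; ∣p∣≤∣x∷p∣; drop-there)
open import Data.List using (List; []; _∷_; filter; allFin; length)
open import Data.List.Membership.Propositional using () renaming (_∈_ to _∈ˡ_)
open import Data.List.Membership.Propositional.Properties using (∈-filter⁺; ∈-filter⁻; ∈-allFin)
open import Data.List.Relation.Unary.All using ([]; _∷_)
open import Data.List.Relation.Unary.AllPairs using ([]; _∷_)
open import Data.List.Relation.Unary.Any using (here; there)
open import Data.List.Relation.Unary.Unique.Propositional.Properties using (filter⁺; allFin⁺)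
import Data.Nat as ℕ
open import Data.Nat using (suc; _+_; z≤n; s≤s)
open import Data.Nat.Properties using (≤-trans; +-monoʳ-≤; +-suc; ≤⇒≯; *-monoʳ-≤)
open import Data.Product using (_,_; proj₁; proj₂)
open import Data.Product.Properties using () renaming (≡-dec to ×-≡-dec)
open import Data.Sum using (_⊎_; inj₁; inj₂)
import Data.Sum as Sum
open import Data.Vec using (Vec; []; _∷_; lookup; tabulate; _++_; splitAt; here; there)
open import Data.Vec.Properties using (lookup∘tabulate; lookup⇒[]=; ≡-dec)
open import Function using (_∘_; _⇔_; mk⇔; Equivalence; Inverse; Injection; id)
open import Function.Construct.Identity using (⇔-id)
open import Function.Properties.Inverse using (↔⇒↣)
open import Relation.Nullary using (Dec; does; yes; no; ¬_; ¬?; contradiction)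
open import Relation.Nullary.Decidable using (_×-dec_; _⊎-dec_; _→-dec_; map′; dec-true; from-yes)
open import Relation.Unary using (Pred; Decidable)
open import Relation.Binary.PropositionalEquality
  using (_≡_; _≢_; refl; sym; trans; cong; cong₂; subst)

containsPair? : (b : Block) (x y : Point) → Dec (ContainsPair b x y)
containsPair? b x y = map′ (λ (i , bᵢ≡x , j , i<j , bⱼ≡y) → i , j , i<j , bᵢ≡x , bⱼ≡y)
                           (λ (i , j , i<j , bᵢ≡x , bⱼ≡y) → i , bᵢ≡x , j , i<j , bⱼ≡y)
                           (any? λ i → lookup b i ≟ x ×-dec any? λ j → i <? j ×-dec lookup b j ≟ y)

_∈B?_ : (x : Point) (b : Block) → Dec (x ∈B b)
x ∈B? b = any? λ i → lookup b i ≟ x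

transversal? : (b : Block) → Dec (Transversal b)
transversal? b = all? λ i → all? λ j → ¬? (i ≟ j) →-dec ¬? (group (lookup b i) ≟ group (lookup b j))

_∈Blocks_ : ∀ {n} → Block → (Fin n → Block) → Set
b ∈Blocks B = ∃[ k ] B k ≡ b

_∈Blocks?_ : ∀ {n} (b : Block) (B : Fin n → Block) → Dec (b ∈Blocks B)
b ∈Blocks? B = any? λ k → ≡-dec _≟_ (B k) b

-- The pair condition of IsDGDD is literally ExactlyTwo (λ k → ContainsPair (B k) x y).
ExactlyTwo : ∀ {n} → Pred (Fin n) _ → Set
ExactlyTwo P = ∃[ k₁ ] ∃[ k₂ ] (k₁ ≢ k₂ × P k₁ × P k₂ × (∀ k → P k → k ≡ k₁ ⊎ k ≡ k₂))

ExactlyTwo-fromFilter : ∀ {n} {P : Pred (Fin n) _} (P? : Decidable P) →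
                        length (filter P? (allFin n)) ≡ 2 → ExactlyTwo P
ExactlyTwo-fromFilter {n} P? _ with filter P? (allFin n) in eq | filter⁺ P? (allFin⁺ n)
ExactlyTwo-fromFilter P? () | [] | _
ExactlyTwo-fromFilter P? () | _ ∷ [] | _
ExactlyTwo-fromFilter P? () | _ ∷ _ ∷ _ ∷ _ | _
ExactlyTwo-fromFilter {n} {P} P? _ | a ∷ b ∷ [] | (a≢b ∷ []) ∷ _ =
  a , b , a≢b , satisfies (here refl) , satisfies (there (here refl)) , onlyTwo
  where
  satisfies : ∀ {k} → k ∈ˡ a ∷ b ∷ [] → P k
  satisfies k∈ = proj₂ (∈-filter⁻ P? {xs = allFin n} (subst (_ ∈ˡ_) (sym eq) k∈))
  onlyTwo : ∀ k → P k → k ≡ a ⊎ k ≡ b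
  onlyTwo k Pk with subst (k ∈ˡ_) eq (∈-filter⁺ P? (∈-allFin k) Pk)
  ... | here k≡a         = inj₁ k≡a
  ... | there (here k≡b) = inj₂ k≡b

ExactlyTwo-permute : ∀ {n} {P P′ : Pred (Fin n) _} (π : Permutation′ n) →
                     (∀ k → P′ k ⇔ P (π ⟨$⟩ʳ k)) → ExactlyTwo P → ExactlyTwo P′
ExactlyTwo-permute {P = P} {P′} π P′⇔Pπ (k₁ , k₂ , k₁≢k₂ , Pk₁ , Pk₂ , onlyTwo) =
  π ⟨$⟩ˡ k₁ , π ⟨$⟩ˡ k₂ , k₁≢k₂ ∘ ⟨$⟩ˡ-injective , P′-at k₁ Pk₁ , P′-at k₂ Pk₂ ,
  λ k P′k → Sum.map (move k) (move k) (onlyTwo (π ⟨$⟩ʳ k) (Equivalence.to (P′⇔Pπ k) P′k))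
  where
  ⟨$⟩ˡ-injective : ∀ {i j} → π ⟨$⟩ˡ i ≡ π ⟨$⟩ˡ j → i ≡ j
  ⟨$⟩ˡ-injective e = trans (sym (inverseʳ π)) (trans (cong (π ⟨$⟩ʳ_) e) (inverseʳ π))
  P′-at : ∀ i → P i → P′ (π ⟨$⟩ˡ i)
  P′-at i Pi = Equivalence.from (P′⇔Pπ (π ⟨$⟩ˡ i)) (subst P (sym (inverseʳ π)) Pi)
  move : ∀ k {i} → π ⟨$⟩ʳ k ≡ i → k ≡ π ⟨$⟩ˡ i
  move k e = trans (sym (inverseˡ π)) (cong (π ⟨$⟩ˡ_) e)

blocksContaining : ∀ {n} → (Fin n → Block) → Point → Point → List (Fin n)
blocksContaining B x y = filter (λ k → containsPair? (B k) x y) (allFin _)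

IsDGDD-fromCounts : ∀ {n} (B : Fin n → Block) → (∀ k → Transversal (B k)) →
                    (∀ x y → group x ≢ group y → length (blocksContaining B x y) ≡ 2) → IsDGDD B
IsDGDD-fromCounts B transversal twoBlocks =
  transversal , λ x y x≁y →
    ExactlyTwo-fromFilter (λ k → containsPair? (B k) x y) (twoBlocks x y x≁y)

distinct³∈p⇒3≤∣p∣ : ∀ {n} {p : Subset n} {x y z} →
                    x ≢ y → x ≢ z → y ≢ z → x ∈ p → y ∈ p → z ∈ p → 3 ≤ ∣ p ∣
distinct³∈p⇒3≤∣p∣ {p = p} {x} {y} {z} x≢y x≢z y≢z x∈p y∈p z∈p =
  ≤-trans (s≤s (≤-trans (s≤s (≤-trans (s≤s z≤n) (x∈p⇒∣p-x∣<∣p∣ z∈p-x-y)))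
                        (x∈p⇒∣p-x∣<∣p∣ y∈p-x)))
          (x∈p⇒∣p-x∣<∣p∣ x∈p)
  where
  y∈p-x : y ∈ p - x
  y∈p-x = x∈p∧x≢y⇒x∈p-y y∈p (x≢y ∘ sym)
  z∈p-x-y : z ∈ p - x - y
  z∈p-x-y = x∈p∧x≢y⇒x∈p-y (x∈p∧x≢y⇒x∈p-y z∈p (x≢z ∘ sym)) (y≢z ∘ sym)

sharedPositions : Block → Block → Subset 5
sharedPositions b c = tabulate λ i → does (lookup b i ∈B? c)

∈-sharedPositions : ∀ b c i → lookup b i ∈B c → i ∈ sharedPositions b c
∈-sharedPositions b c i bᵢ∈c = lookup⇒[]= i _
  (trans (lookup∘tabulate (λ i → does (lookup b i ∈B? c)) i) (dec-true (lookup b i ∈B? c) bᵢ∈c))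

SuperSimple-fromShared : ∀ {n} (B : Fin n → Block) →
                         (∀ k l → k ≢ l → ∣ sharedPositions (B k) (B l) ∣ ≤ 2) → SuperSimple B
SuperSimple-fromShared B fewShared k l k≢l x y z x≢y x≢z y≢z
  (i , bᵢ≡x) (j , bⱼ≡y) (m , bₘ≡z) x∈Bl y∈Bl z∈Bl =
  ≤⇒≯ (fewShared k l k≢l)
    (distinct³∈p⇒3≤∣p∣ (distinct bᵢ≡x bⱼ≡y x≢y) (distinct bᵢ≡x bₘ≡z x≢z) (distinct bⱼ≡y bₘ≡z y≢z)
           (shared i bᵢ≡x x∈Bl) (shared j bⱼ≡y y∈Bl) (shared m bₘ≡z z∈Bl))
  where
  distinct : ∀ {i j u v} → lookup (B k) i ≡ u → lookup (B k) j ≡ v → u ≢ v → i ≢ j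
  distinct bᵢ≡u bⱼ≡v u≢v refl = u≢v (trans (sym bᵢ≡u) bⱼ≡v)
  shared : ∀ i {u} → lookup (B k) i ≡ u → u ∈B B l → i ∈ sharedPositions (B k) (B l)
  shared i refl = ∈-sharedPositions (B k) (B l) i

permuteBlock : Permutation′ 5 → Block → Block
permuteBlock π b = tabulate (lookup b ∘ (π ⟨$⟩ʳ_))

lookup-permuteBlock : ∀ π b k → lookup (permuteBlock π b) k ≡ lookup b (π ⟨$⟩ʳ k)
lookup-permuteBlock π b = lookup∘tabulate (lookup b ∘ (π ⟨$⟩ʳ_))

Transversal-permute : ∀ π b → Transversal b → Transversal (permuteBlock π b)
Transversal-permute π b transversal i j i≢j
  rewrite lookup-permuteBlock π b i | lookup-permuteBlock π b j =
  transversal (π ⟨$⟩ʳ i) (π ⟨$⟩ʳ j) (i≢j ∘ Injection.injective (↔⇒↣ π))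

adjacentTransposition : Fin 4 → Permutation′ 5
adjacentTransposition i = transpose (inject₁ i) (suc i)

swapAdjacent : Fin 4 → Block → Block
swapAdjacent i = permuteBlock (adjacentTransposition i)

swapAdjacent-transversal : ∀ i b → Transversal b → Transversal (swapAdjacent i b)
swapAdjacent-transversal i = Transversal-permute (adjacentTransposition i)

adjacentTransposition-monotone : ∀ i k l → k < l →
  adjacentTransposition i ⟨$⟩ʳ k < adjacentTransposition i ⟨$⟩ʳ l ⊎
  (adjacentTransposition i ⟨$⟩ʳ k ≡ suc i × adjacentTransposition i ⟨$⟩ʳ l ≡ inject₁ i)
adjacentTransposition-monotone = from-yes (all? λ i → all? λ k → all? λ l → k <? l →-dec
  (adjacentTransposition i ⟨$⟩ʳ k <? adjacentTransposition i ⟨$⟩ʳ l ⊎-dec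
   (adjacentTransposition i ⟨$⟩ʳ k ≟ suc i ×-dec adjacentTransposition i ⟨$⟩ʳ l ≟ inject₁ i)))

adjacentTransposition⁻¹-monotone : ∀ i k l → k < l →
  adjacentTransposition i ⟨$⟩ˡ k < adjacentTransposition i ⟨$⟩ˡ l ⊎ (k ≡ inject₁ i × l ≡ suc i)
adjacentTransposition⁻¹-monotone = from-yes (all? λ i → all? λ k → all? λ l → k <? l →-dec
  (adjacentTransposition i ⟨$⟩ˡ k <? adjacentTransposition i ⟨$⟩ˡ l ⊎-dec
   (k ≟ inject₁ i ×-dec l ≟ suc i)))

transpose-matchˡ : ∀ {n} (a b : Fin n) → transpose a b ⟨$⟩ʳ a ≡ b
transpose-matchˡ a b rewrite dec-true (a ≟ a) refl = refl

transpose-matchʳ : ∀ {n} (a b : Fin n) → transpose a b ⟨$⟩ʳ b ≡ a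
transpose-matchʳ a b with b ≟ a
... | yes refl = refl
... | no _ rewrite dec-true (b ≟ b) refl = refl

Transversal⇒lookup-injective : ∀ b → Transversal b → ∀ {k l} → lookup b k ≡ lookup b l → k ≡ l
Transversal⇒lookup-injective b transversal {k} {l} bₖ≡bₗ with k ≟ l
... | yes k≡l = k≡l
... | no k≢l  = contradiction (cong group bₖ≡bₗ) (transversal k l k≢l)

ContainsPair-adjacent : ∀ b i {x y} →
                        lookup b (inject₁ i) ≡ x → lookup b (suc i) ≡ y → ContainsPair b x y
ContainsPair-adjacent b i bᵢ≡x bᵢ₊₁≡y = inject₁ i , suc i , ≤̄⇒inject₁< ≤-refl , bᵢ≡x , bᵢ₊₁≡y

¬ContainsPair-reversed : ∀ b → Transversal b → ∀ i {x y} →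
                         lookup b (inject₁ i) ≡ x → lookup b (suc i) ≡ y → ¬ ContainsPair b y x
¬ContainsPair-reversed b transversal i refl refl (k , l , k<l , bₖ≡y , bₗ≡x)
  with Transversal⇒lookup-injective b transversal {k} {suc i} bₖ≡y
     | Transversal⇒lookup-injective b transversal {l} {inject₁ i} bₗ≡x
... | refl | refl = <-asym k<l (≤̄⇒inject₁< ≤-refl)

swapAdjacent-inject₁ : ∀ i b → lookup (swapAdjacent i b) (inject₁ i) ≡ lookup b (suc i)
swapAdjacent-inject₁ i b = trans (lookup-permuteBlock (adjacentTransposition i) b (inject₁ i))
                                 (cong (lookup b) (transpose-matchˡ (inject₁ i) (suc i)))

swapAdjacent-suc : ∀ i b → lookup (swapAdjacent i b) (suc i) ≡ lookup b (inject₁ i)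
swapAdjacent-suc i b = trans (lookup-permuteBlock (adjacentTransposition i) b (suc i))
                             (cong (lookup b) (transpose-matchʳ (inject₁ i) (suc i)))

ContainsPair-swapAdjacent : ∀ i b {u v} →
  (u , v) ≢ (lookup b (inject₁ i) , lookup b (suc i)) →
  (u , v) ≢ (lookup b (suc i) , lookup b (inject₁ i)) →
  ContainsPair (swapAdjacent i b) u v ⇔ ContainsPair b u v
ContainsPair-swapAdjacent i b {u} {v} ≢xy ≢yx = mk⇔ to from
  where
  τ : Permutation′ 5
  τ = adjacentTransposition i
  at : ∀ k → lookup (swapAdjacent i b) k ≡ lookup b (τ ⟨$⟩ʳ k)
  at = lookup-permuteBlock τ b
  to : ContainsPair (swapAdjacent i b) u v → ContainsPair b u v
  to (k , l , k<l , b′ₖ≡u , b′ₗ≡v) with adjacentTransposition-monotone i k l k<l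
  ... | inj₁ τk<τl =
    τ ⟨$⟩ʳ k , τ ⟨$⟩ʳ l , τk<τl , trans (sym (at k)) b′ₖ≡u , trans (sym (at l)) b′ₗ≡v
  ... | inj₂ (τk≡i+1 , τl≡i) = contradiction
    (cong₂ _,_ (trans (sym b′ₖ≡u) (trans (at k) (cong (lookup b) τk≡i+1)))
               (trans (sym b′ₗ≡v) (trans (at l) (cong (lookup b) τl≡i)))) ≢yx
  from : ContainsPair b u v → ContainsPair (swapAdjacent i b) u v
  from (k , l , k<l , bₖ≡u , bₗ≡v) with adjacentTransposition⁻¹-monotone i k l k<l
  ... | inj₁ lt = τ ⟨$⟩ˡ k , τ ⟨$⟩ˡ l , lt ,
                  trans (at (τ ⟨$⟩ˡ k)) (trans (cong (lookup b) (inverseʳ τ)) bₖ≡u) ,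
                  trans (at (τ ⟨$⟩ˡ l)) (trans (cong (lookup b) (inverseʳ τ)) bₗ≡v)
  ... | inj₂ (refl , refl) = contradiction (cong₂ _,_ (sym bₖ≡u) (sym bₗ≡v)) ≢xy

SameCoverage : (b₁ b₂ c₁ c₂ : Block) → Point → Point → Set
SameCoverage b₁ b₂ c₁ c₂ x y =
  (ContainsPair b₁ x y ⇔ ContainsPair c₁ x y × ContainsPair b₂ x y ⇔ ContainsPair c₂ x y) ⊎
  (ContainsPair b₁ x y ⇔ ContainsPair c₂ x y × ContainsPair b₂ x y ⇔ ContainsPair c₁ x y)

AdjacentReversed : Block → Fin 4 → Block → Fin 4 → Set
AdjacentReversed b i c j =
  lookup c (inject₁ j) ≡ lookup b (suc i) × lookup c (suc j) ≡ lookup b (inject₁ i)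

adjacentReversed? : ∀ b i c j → Dec (AdjacentReversed b i c j)
adjacentReversed? b i c j =
  lookup c (inject₁ j) ≟ lookup b (suc i) ×-dec lookup c (suc j) ≟ lookup b (inject₁ i)

module _ (b c : Block) (i j : Fin 4) (b-transversal : Transversal b) (c-transversal : Transversal c)
         (reversed : AdjacentReversed b i c j) where
  private
    cⱼ≡y : lookup c (inject₁ j) ≡ lookup b (suc i)
    cⱼ≡y = proj₁ reversed
    cⱼ₊₁≡x : lookup c (suc j) ≡ lookup b (inject₁ i)
    cⱼ₊₁≡x = proj₂ reversed
    x y : Point
    x = lookup b (inject₁ i)
    y = lookup b (suc i)
    b′ c′ : Block
    b′ = swapAdjacent i b
    c′ = swapAdjacent j c
    b′ᵢ≡y : lookup b′ (inject₁ i) ≡ y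
    b′ᵢ≡y = swapAdjacent-inject₁ i b
    b′ᵢ₊₁≡x : lookup b′ (suc i) ≡ x
    b′ᵢ₊₁≡x = swapAdjacent-suc i b
    c′ⱼ≡x : lookup c′ (inject₁ j) ≡ x
    c′ⱼ≡x = trans (swapAdjacent-inject₁ j c) cⱼ₊₁≡x
    c′ⱼ₊₁≡y : lookup c′ (suc j) ≡ y
    c′ⱼ₊₁≡y = trans (swapAdjacent-suc j c) cⱼ≡y
    both : ∀ {A B : Set} → A → B → A ⇔ B
    both a b = mk⇔ (λ _ → b) (λ _ → a)
    neither : ∀ {A B : Set} → ¬ A → ¬ B → A ⇔ B
    neither ¬a ¬b = mk⇔ (λ a → contradiction a ¬a) (λ b → contradiction b ¬b)

  swapTrade-sameCoverage : ∀ u v → SameCoverage b′ c′ b c u v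
  swapTrade-sameCoverage u v with ×-≡-dec _≟_ _≟_ (u , v) (x , y) | ×-≡-dec _≟_ _≟_ (u , v) (y , x)
  ... | yes refl | _ = inj₂
    (neither (¬ContainsPair-reversed b′ (swapAdjacent-transversal i b b-transversal) i b′ᵢ≡y b′ᵢ₊₁≡x)
             (¬ContainsPair-reversed c c-transversal j cⱼ≡y cⱼ₊₁≡x) ,
     both (ContainsPair-adjacent c′ j c′ⱼ≡x c′ⱼ₊₁≡y) (ContainsPair-adjacent b i refl refl))
  ... | no _ | yes refl = inj₂
    (both (ContainsPair-adjacent b′ i b′ᵢ≡y b′ᵢ₊₁≡x) (ContainsPair-adjacent c j cⱼ≡y cⱼ₊₁≡x) ,
     neither (¬ContainsPair-reversed c′ (swapAdjacent-transversal j c c-transversal) j c′ⱼ≡x c′ⱼ₊₁≡y)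
             (¬ContainsPair-reversed b b-transversal i refl refl))
  ... | no ≢xy | no ≢yx = inj₁
    (ContainsPair-swapAdjacent i b ≢xy ≢yx ,
     ContainsPair-swapAdjacent j c (λ e → ≢yx (trans e (cong₂ _,_ cⱼ≡y cⱼ₊₁≡x)))
                                   (λ e → ≢xy (trans e (cong₂ _,_ cⱼ₊₁≡x cⱼ≡y))))

agreeingDGDD-usesBlocks : ∀ {n} {B : Fin n → Block} {S} → IsDefiningSet B S →
                          (B′ : Fin n → Block) → IsDGDD B′ → (∀ k → k ∈ S → B′ k ≡ B k) →
                          ∀ j → B′ j ∈Blocks B
agreeingDGDD-usesBlocks {n} S-defines B′ B′-isDGDD agree j
  with S-defines n B′ B′-isDGDD (id , (λ _ _ _ _ → id) , agree)
... | e , B′∘e≡B = Inverse.from e j ,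
  trans (sym (B′∘e≡B (Inverse.from e j))) (cong B′ (Inverse.strictlyInverseˡ e j))

module Trade {n} (B : Fin n → Block) (p q : Fin n) (b₁ b₂ : Block) where

  traded : Fin n → Block
  traded k with k ≟ p | k ≟ q
  ... | yes _ | _     = b₁
  ... | no _  | yes _ = b₂
  ... | no _  | no _  = B k

  traded-isDGDD : IsDGDD B → Transversal b₁ → Transversal b₂ →
                  (∀ x y → SameCoverage b₁ b₂ (B p) (B q) x y) → IsDGDD traded
  traded-isDGDD (transversal , exactlyTwo) b₁-transversal b₂-transversal sameCoverage =
    traded-transversal , λ x y x≁y → traded-exactlyTwo x y (sameCoverage x y) (exactlyTwo x y x≁y)
    where
    traded-transversal : ∀ k → Transversal (traded k)
    traded-transversal k with k ≟ p | k ≟ q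
    ... | yes _ | _     = b₁-transversal
    ... | no _  | yes _ = b₂-transversal
    ... | no _  | no _  = transversal k
    traded-exactlyTwo : ∀ x y → SameCoverage b₁ b₂ (B p) (B q) x y →
                        ExactlyTwo (λ k → ContainsPair (B k) x y) →
                        ExactlyTwo (λ k → ContainsPair (traded k) x y)
    traded-exactlyTwo x y (inj₁ (b₁∼Bp , b₂∼Bq)) = ExactlyTwo-permute Permutation.id kept
      where
      kept : ∀ k → ContainsPair (traded k) x y ⇔ ContainsPair (B k) x y
      kept k with k ≟ p | k ≟ q
      ... | yes refl | _        = b₁∼Bp
      ... | no _     | yes refl = b₂∼Bq
      ... | no _     | no _     = ⇔-id _
    traded-exactlyTwo x y (inj₂ (b₁∼Bq , b₂∼Bp)) = ExactlyTwo-permute (transpose p q) exchanged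
      where
      exchanged : ∀ k → ContainsPair (traded k) x y ⇔ ContainsPair (B (transpose p q ⟨$⟩ʳ k)) x y
      exchanged k with k ≟ p
      ... | yes refl = b₁∼Bq
      ... | no _ with k ≟ q
      ...   | yes refl = b₂∼Bp
      ...   | no _     = ⇔-id _

  traded-p : traded p ≡ b₁
  traded-p with p ≟ p | p ≟ q
  ... | yes _  | _ = refl
  ... | no p≢p | _ = contradiction refl p≢p

  definingSet-meets : ∀ {S} → IsDefiningSet B S → IsDGDD traded → ¬ (b₁ ∈Blocks B) → p ∈ S ⊎ q ∈ S
  definingSet-meets {S} S-defines traded-dgdd b₁∉B with p ∈? S | q ∈? S
  ... | yes p∈S | _       = inj₁ p∈S
  ... | no _    | yes q∈S = inj₂ q∈S
  ... | no p∉S  | no q∉S  = contradiction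
    (subst (_∈Blocks B) traded-p (agreeingDGDD-usesBlocks S-defines traded traded-dgdd agree p))
    b₁∉B
    where
    agree : ∀ k → k ∈ S → traded k ≡ B k
    agree k k∈S with k ≟ p | k ≟ q
    ... | yes refl | _        = contradiction k∈S p∉S
    ... | no _     | yes refl = contradiction k∈S q∉S
    ... | no _     | no _     = refl

∣p++q∣≡∣p∣+∣q∣ : ∀ {m n} (p : Subset m) (q : Subset n) → ∣ p ++ q ∣ ≡ ∣ p ∣ + ∣ q ∣
∣p++q∣≡∣p∣+∣q∣ []             q = refl
∣p++q∣≡∣p∣+∣q∣ (inside ∷ p)  q = cong suc (∣p++q∣≡∣p∣+∣q∣ p q)
∣p++q∣≡∣p∣+∣q∣ (outside ∷ p) q = ∣p++q∣≡∣p∣+∣q∣ p q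

↑ˡ∈p++q⇒∈p : ∀ {m n} (p : Subset m) {q : Subset n} {t} → t ↑ˡ n ∈ p ++ q → t ∈ p
↑ˡ∈p++q⇒∈p (_ ∷ p) {t = zero}  here        = here
↑ˡ∈p++q⇒∈p (_ ∷ p) {t = suc t} (there t∈p) = there (↑ˡ∈p++q⇒∈p p t∈p)

↑ʳ∈p++q⇒∈q : ∀ {m n} (p : Subset m) {q : Subset n} {t} → m ↑ʳ t ∈ p ++ q → t ∈ q
↑ʳ∈p++q⇒∈q []      t∈q         = t∈q
↑ʳ∈p++q⇒∈q (_ ∷ p) (there t∈q) = ↑ʳ∈p++q⇒∈q p t∈q

covering⇒n≤∣p∣+∣q∣ : ∀ {n} (p q : Subset n) → (∀ t → t ∈ p ⊎ t ∈ q) → n ≤ ∣ p ∣ + ∣ q ∣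
covering⇒n≤∣p∣+∣q∣ [] [] _ = z≤n
covering⇒n≤∣p∣+∣q∣ (inside ∷ p) (s ∷ q) covers =
  s≤s (≤-trans (covering⇒n≤∣p∣+∣q∣ p q (Sum.map drop-there drop-there ∘ covers ∘ suc))
               (+-monoʳ-≤ ∣ p ∣ (∣p∣≤∣x∷p∣ s q)))
covering⇒n≤∣p∣+∣q∣ {suc n} (outside ∷ p) (inside ∷ q) covers =
  subst (suc n ≤_) (sym (+-suc ∣ p ∣ ∣ q ∣))
    (s≤s (covering⇒n≤∣p∣+∣q∣ p q (Sum.map drop-there drop-there ∘ covers ∘ suc)))
covering⇒n≤∣p∣+∣q∣ (outside ∷ p) (outside ∷ q) covers with covers zero
... | inj₁ ()
... | inj₂ ()

meetsHalves⇒m≤∣S∣ : ∀ {m} (S : Subset (m + m)) → (∀ t → t ↑ˡ m ∈ S ⊎ m ↑ʳ t ∈ S) → m ≤ ∣ S ∣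
meetsHalves⇒m≤∣S∣ {m} S meets with splitAt m S
... | p , q , refl = subst (m ≤_) (sym (∣p++q∣≡∣p∣+∣q∣ p q))
  (covering⇒n≤∣p∣+∣q∣ p q (Sum.map (↑ˡ∈p++q⇒∈p p) (↑ʳ∈p++q⇒∈q p) ∘ meets))

designBlocks : Vec Block 100
designBlocks =
  (# 1 ∷ # 8 ∷ # 10 ∷ # 17 ∷ # 24 ∷ []) ∷
  (# 1 ∷ # 9 ∷ # 12 ∷ # 15 ∷ # 23 ∷ []) ∷
  (# 1 ∷ # 5 ∷ # 14 ∷ # 18 ∷ # 22 ∷ []) ∷
  (# 1 ∷ # 6 ∷ # 11 ∷ # 16 ∷ # 21 ∷ []) ∷
  (# 1 ∷ # 7 ∷ # 13 ∷ # 19 ∷ # 20 ∷ []) ∷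
  (# 3 ∷ # 7 ∷ # 11 ∷ # 15 ∷ # 24 ∷ []) ∷
  (# 3 ∷ # 6 ∷ # 14 ∷ # 17 ∷ # 20 ∷ []) ∷
  (# 3 ∷ # 5 ∷ # 12 ∷ # 19 ∷ # 21 ∷ []) ∷
  (# 0 ∷ # 9 ∷ # 13 ∷ # 17 ∷ # 21 ∷ []) ∷
  (# 3 ∷ # 9 ∷ # 10 ∷ # 16 ∷ # 22 ∷ []) ∷
  (# 2 ∷ # 7 ∷ # 12 ∷ # 17 ∷ # 22 ∷ []) ∷
  (# 2 ∷ # 6 ∷ # 10 ∷ # 19 ∷ # 23 ∷ []) ∷
  (# 4 ∷ # 8 ∷ # 12 ∷ # 16 ∷ # 20 ∷ []) ∷
  (# 2 ∷ # 8 ∷ # 14 ∷ # 15 ∷ # 21 ∷ []) ∷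
  (# 2 ∷ # 9 ∷ # 11 ∷ # 18 ∷ # 20 ∷ []) ∷
  (# 0 ∷ # 8 ∷ # 11 ∷ # 19 ∷ # 22 ∷ []) ∷
  (# 0 ∷ # 7 ∷ # 14 ∷ # 16 ∷ # 23 ∷ []) ∷
  (# 0 ∷ # 6 ∷ # 12 ∷ # 18 ∷ # 24 ∷ []) ∷
  (# 4 ∷ # 9 ∷ # 14 ∷ # 19 ∷ # 24 ∷ []) ∷
  (# 3 ∷ # 8 ∷ # 13 ∷ # 18 ∷ # 23 ∷ []) ∷
  (# 2 ∷ # 5 ∷ # 13 ∷ # 16 ∷ # 24 ∷ []) ∷
  (# 4 ∷ # 6 ∷ # 13 ∷ # 15 ∷ # 22 ∷ []) ∷
  (# 4 ∷ # 5 ∷ # 11 ∷ # 17 ∷ # 23 ∷ []) ∷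
  (# 0 ∷ # 5 ∷ # 10 ∷ # 15 ∷ # 20 ∷ []) ∷
  (# 4 ∷ # 7 ∷ # 10 ∷ # 18 ∷ # 21 ∷ []) ∷
  (# 1 ∷ # 9 ∷ # 14 ∷ # 16 ∷ # 20 ∷ []) ∷
  (# 1 ∷ # 5 ∷ # 11 ∷ # 19 ∷ # 24 ∷ []) ∷
  (# 1 ∷ # 6 ∷ # 13 ∷ # 17 ∷ # 23 ∷ []) ∷
  (# 1 ∷ # 7 ∷ # 10 ∷ # 15 ∷ # 22 ∷ []) ∷
  (# 1 ∷ # 8 ∷ # 12 ∷ # 18 ∷ # 21 ∷ []) ∷
  (# 3 ∷ # 8 ∷ # 10 ∷ # 19 ∷ # 20 ∷ []) ∷
  (# 3 ∷ # 7 ∷ # 13 ∷ # 16 ∷ # 21 ∷ []) ∷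
  (# 3 ∷ # 6 ∷ # 11 ∷ # 18 ∷ # 22 ∷ []) ∷
  (# 0 ∷ # 5 ∷ # 12 ∷ # 16 ∷ # 22 ∷ []) ∷
  (# 3 ∷ # 5 ∷ # 14 ∷ # 15 ∷ # 23 ∷ []) ∷
  (# 2 ∷ # 8 ∷ # 11 ∷ # 16 ∷ # 23 ∷ []) ∷
  (# 2 ∷ # 7 ∷ # 14 ∷ # 18 ∷ # 24 ∷ []) ∷
  (# 4 ∷ # 9 ∷ # 11 ∷ # 15 ∷ # 21 ∷ []) ∷
  (# 2 ∷ # 9 ∷ # 13 ∷ # 19 ∷ # 22 ∷ []) ∷
  (# 2 ∷ # 5 ∷ # 10 ∷ # 17 ∷ # 21 ∷ []) ∷
  (# 0 ∷ # 9 ∷ # 10 ∷ # 18 ∷ # 23 ∷ []) ∷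
  (# 0 ∷ # 8 ∷ # 13 ∷ # 15 ∷ # 24 ∷ []) ∷
  (# 0 ∷ # 7 ∷ # 11 ∷ # 17 ∷ # 20 ∷ []) ∷
  (# 4 ∷ # 5 ∷ # 13 ∷ # 18 ∷ # 20 ∷ []) ∷
  (# 3 ∷ # 9 ∷ # 12 ∷ # 17 ∷ # 24 ∷ []) ∷
  (# 2 ∷ # 6 ∷ # 12 ∷ # 15 ∷ # 20 ∷ []) ∷
  (# 4 ∷ # 7 ∷ # 12 ∷ # 19 ∷ # 23 ∷ []) ∷
  (# 4 ∷ # 6 ∷ # 10 ∷ # 16 ∷ # 24 ∷ []) ∷
  (# 0 ∷ # 6 ∷ # 14 ∷ # 19 ∷ # 21 ∷ []) ∷
  (# 4 ∷ # 8 ∷ # 14 ∷ # 17 ∷ # 22 ∷ []) ∷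
  (# 24 ∷ # 17 ∷ # 14 ∷ # 5 ∷ # 0 ∷ []) ∷
  (# 23 ∷ # 15 ∷ # 11 ∷ # 6 ∷ # 0 ∷ []) ∷
  (# 22 ∷ # 18 ∷ # 13 ∷ # 7 ∷ # 0 ∷ []) ∷
  (# 21 ∷ # 16 ∷ # 10 ∷ # 8 ∷ # 0 ∷ []) ∷
  (# 20 ∷ # 19 ∷ # 12 ∷ # 9 ∷ # 0 ∷ []) ∷
  (# 21 ∷ # 19 ∷ # 11 ∷ # 7 ∷ # 2 ∷ []) ∷
  (# 22 ∷ # 16 ∷ # 14 ∷ # 6 ∷ # 2 ∷ []) ∷
  (# 23 ∷ # 18 ∷ # 12 ∷ # 5 ∷ # 2 ∷ []) ∷
  (# 20 ∷ # 17 ∷ # 13 ∷ # 8 ∷ # 2 ∷ []) ∷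
  (# 24 ∷ # 15 ∷ # 10 ∷ # 9 ∷ # 2 ∷ []) ∷
  (# 22 ∷ # 17 ∷ # 11 ∷ # 9 ∷ # 1 ∷ []) ∷
  (# 23 ∷ # 19 ∷ # 14 ∷ # 8 ∷ # 1 ∷ []) ∷
  (# 24 ∷ # 16 ∷ # 12 ∷ # 7 ∷ # 1 ∷ []) ∷
  (# 21 ∷ # 15 ∷ # 13 ∷ # 5 ∷ # 1 ∷ []) ∷
  (# 20 ∷ # 18 ∷ # 10 ∷ # 6 ∷ # 1 ∷ []) ∷
  (# 24 ∷ # 18 ∷ # 11 ∷ # 8 ∷ # 4 ∷ []) ∷
  (# 20 ∷ # 15 ∷ # 14 ∷ # 7 ∷ # 4 ∷ []) ∷
  (# 21 ∷ # 17 ∷ # 12 ∷ # 6 ∷ # 4 ∷ []) ∷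
  (# 21 ∷ # 18 ∷ # 14 ∷ # 9 ∷ # 3 ∷ []) ∷
  (# 22 ∷ # 15 ∷ # 12 ∷ # 8 ∷ # 3 ∷ []) ∷
  (# 23 ∷ # 16 ∷ # 13 ∷ # 9 ∷ # 4 ∷ []) ∷
  (# 24 ∷ # 19 ∷ # 13 ∷ # 6 ∷ # 3 ∷ []) ∷
  (# 20 ∷ # 16 ∷ # 11 ∷ # 5 ∷ # 3 ∷ []) ∷
  (# 22 ∷ # 19 ∷ # 10 ∷ # 5 ∷ # 4 ∷ []) ∷
  (# 23 ∷ # 17 ∷ # 10 ∷ # 7 ∷ # 3 ∷ []) ∷
  (# 20 ∷ # 16 ∷ # 13 ∷ # 6 ∷ # 0 ∷ []) ∷
  (# 24 ∷ # 19 ∷ # 10 ∷ # 7 ∷ # 0 ∷ []) ∷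
  (# 23 ∷ # 17 ∷ # 12 ∷ # 8 ∷ # 0 ∷ []) ∷
  (# 22 ∷ # 15 ∷ # 14 ∷ # 9 ∷ # 0 ∷ []) ∷
  (# 21 ∷ # 18 ∷ # 11 ∷ # 5 ∷ # 0 ∷ []) ∷
  (# 22 ∷ # 18 ∷ # 10 ∷ # 8 ∷ # 2 ∷ []) ∷
  (# 23 ∷ # 15 ∷ # 13 ∷ # 7 ∷ # 2 ∷ []) ∷
  (# 24 ∷ # 17 ∷ # 11 ∷ # 6 ∷ # 2 ∷ []) ∷
  (# 21 ∷ # 16 ∷ # 12 ∷ # 9 ∷ # 2 ∷ []) ∷
  (# 20 ∷ # 19 ∷ # 14 ∷ # 5 ∷ # 2 ∷ []) ∷
  (# 23 ∷ # 16 ∷ # 10 ∷ # 5 ∷ # 1 ∷ []) ∷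
  (# 24 ∷ # 18 ∷ # 13 ∷ # 9 ∷ # 1 ∷ []) ∷
  (# 20 ∷ # 15 ∷ # 11 ∷ # 8 ∷ # 1 ∷ []) ∷
  (# 22 ∷ # 19 ∷ # 12 ∷ # 6 ∷ # 1 ∷ []) ∷
  (# 21 ∷ # 17 ∷ # 14 ∷ # 7 ∷ # 1 ∷ []) ∷
  (# 20 ∷ # 17 ∷ # 10 ∷ # 9 ∷ # 4 ∷ []) ∷
  (# 21 ∷ # 19 ∷ # 13 ∷ # 8 ∷ # 4 ∷ []) ∷
  (# 22 ∷ # 16 ∷ # 11 ∷ # 7 ∷ # 4 ∷ []) ∷
  (# 22 ∷ # 17 ∷ # 13 ∷ # 5 ∷ # 3 ∷ []) ∷
  (# 23 ∷ # 19 ∷ # 11 ∷ # 9 ∷ # 3 ∷ []) ∷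
  (# 24 ∷ # 15 ∷ # 12 ∷ # 5 ∷ # 4 ∷ []) ∷
  (# 20 ∷ # 18 ∷ # 12 ∷ # 7 ∷ # 3 ∷ []) ∷
  (# 21 ∷ # 15 ∷ # 10 ∷ # 6 ∷ # 3 ∷ []) ∷
  (# 23 ∷ # 18 ∷ # 14 ∷ # 6 ∷ # 4 ∷ []) ∷
  (# 24 ∷ # 16 ∷ # 14 ∷ # 8 ∷ # 3 ∷ []) ∷
  []

design : Fin 100 → Block
design = lookup designBlocks

-- Trade t swaps positions i, i + 1 of block t and positions 3 − i, 4 − i of block 50 + t,
-- where i is entry t of this table.
swapPositions : Vec (Fin 4) 50
swapPositions =
  # 3 ∷ # 3 ∷ # 3 ∷ # 3 ∷ # 3 ∷ # 1 ∷ # 1 ∷ # 1 ∷ # 2 ∷ # 1 ∷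
  # 3 ∷ # 3 ∷ # 2 ∷ # 3 ∷ # 3 ∷ # 1 ∷ # 1 ∷ # 1 ∷ # 1 ∷ # 0 ∷
  # 2 ∷ # 1 ∷ # 1 ∷ # 1 ∷ # 1 ∷ # 3 ∷ # 3 ∷ # 3 ∷ # 3 ∷ # 3 ∷
  # 1 ∷ # 1 ∷ # 1 ∷ # 2 ∷ # 1 ∷ # 3 ∷ # 3 ∷ # 2 ∷ # 3 ∷ # 3 ∷
  # 1 ∷ # 1 ∷ # 1 ∷ # 1 ∷ # 0 ∷ # 2 ∷ # 1 ∷ # 1 ∷ # 1 ∷ # 1 ∷
  []

swapPosition₁ swapPosition₂ : Fin 50 → Fin 4
swapPosition₁ t = lookup swapPositions t
swapPosition₂ t = opposite (swapPosition₁ t)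

removedBlock₁ removedBlock₂ addedBlock₁ addedBlock₂ : Fin 50 → Block
removedBlock₁ t = design (t ↑ˡ 50)
removedBlock₂ t = design (50 ↑ʳ t)
addedBlock₁ t = swapAdjacent (swapPosition₁ t) (removedBlock₁ t)
addedBlock₂ t = swapAdjacent (swapPosition₂ t) (removedBlock₂ t)

module DesignTrade (t : Fin 50) = Trade design (t ↑ˡ 50) (50 ↑ʳ t) (addedBlock₁ t) (addedBlock₂ t)

design-transversal : ∀ k → Transversal (design k)
design-transversal = from-yes (all? λ k → transversal? (design k))

design-isDGDD : IsDGDD design
design-isDGDD = IsDGDD-fromCounts design design-transversal
  (from-yes (all? λ x → all? λ y →
    ¬? (group x ≟ group y) →-dec length (blocksContaining design x y) ℕ.≟ 2))

design-superSimple : SuperSimple design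
design-superSimple = SuperSimple-fromShared design
  (from-yes (all? λ k → all? λ l →
    ¬? (k ≟ l) →-dec ∣ sharedPositions (design k) (design l) ∣ ℕ.≤? 2))

swappedPairs-reversed : ∀ t →
  AdjacentReversed (removedBlock₁ t) (swapPosition₁ t) (removedBlock₂ t) (swapPosition₂ t)
swappedPairs-reversed = from-yes (all? λ t →
  adjacentReversed? (removedBlock₁ t) (swapPosition₁ t) (removedBlock₂ t) (swapPosition₂ t))

addedBlock₁-new : ∀ t → ¬ (addedBlock₁ t ∈Blocks design)
addedBlock₁-new = from-yes (all? λ t → ¬? (addedBlock₁ t ∈Blocks? design))

traded-isDGDD : ∀ t → IsDGDD (DesignTrade.traded t)
traded-isDGDD t = DesignTrade.traded-isDGDD t design-isDGDD
  (swapAdjacent-transversal (swapPosition₁ t) (removedBlock₁ t) (design-transversal (t ↑ˡ 50)))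
  (swapAdjacent-transversal (swapPosition₂ t) (removedBlock₂ t) (design-transversal (50 ↑ʳ t)))
  (swapTrade-sameCoverage (removedBlock₁ t) (removedBlock₂ t) (swapPosition₁ t) (swapPosition₂ t)
    (design-transversal (t ↑ˡ 50)) (design-transversal (50 ↑ʳ t)) (swappedPairs-reversed t))

lemma3p2 : ∃[ n ] ∃[ B ] (IsDGDD {n} B × SuperSimple B ×
             (∀ (S : Subset n) → IsDefiningSet B S → n ≤ 2 * ∣ S ∣))
lemma3p2 = 100 , design , design-isDGDD , design-superSimple , λ S S-defines →
  *-monoʳ-≤ 2 (meetsHalves⇒m≤∣S∣ S λ t →
    DesignTrade.definingSet-meets t S-defines (traded-isDGDD t) (addedBlock₁-new t))
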